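{- Let $d\ge 1$ and $v$ be positive integers. For every $m\in\{1,2,\dots,7\}$ there is no $3$-way $d$-homogeneous $(v,3,2)$ Steiner trade of volume $m$.
   Context: Let $V$ be a finite set with $v$ elements and let $t<k<v$ be positive integers. A $\mu$-way $(v,k,t)$ trade $T=\{T_1,\dots,T_\mu\}$ of volume $m$ consists of $\mu$ pairwise disjoint collections $T_1,\dots,T_\mu$, each consisting of $m$ blocks (a block is a $k$-subset of $V$), such that for every $t$-subset of $V$ the number of blocks containing it is the same in each $T_i$. All the $T_i$ cover the same set of elements, called the foundation $\mathrm{found}(T)$. The trade is a Steiner trade if every $t$-subset of $\mathrm{found}(T)$ is contained in at most one block of each $T_i$. It is $d$-homogeneous if every element of $V$ lies in exactly $d$ blocks of each $T_i$. -}

module Defs where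

open import Data.Nat using (ℕ; _≤_; _<_)
open import Data.Fin using (Fin)
open import Data.Fin.Subset using (Subset; _⊆_; _∈_; ∣_∣)
open import Data.Fin.Subset.Properties using (_⊆?_; _∈?_)
open import Data.List using (List; length; filter; allFin)
open import Data.Product using (_×_)
open import Relation.Binary.PropositionalEquality using (_≡_; _≢_)
open import Relation.Nullary using (¬_)

-- A block is a subset of V = Fin v.
-- A μ-way trade of volume m on V = Fin v is given as
--   T : Fin μ → Fin m → Subset v   (T i j = j-th block of collection T_i)

countContaining : ∀ {μ m v} → (Fin μ → Fin m → Subset v) → Fin μ → Subset v → ℕ
countContaining {m = m} T i P = length (filter (λ j → P ⊆? T i j) (allFin m))

degree : ∀ {μ m v} → (Fin μ → Fin m → Subset v) → Fin μ → Fin v → ℕ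
degree {m = m} T i x = length (filter (λ j → x ∈? T i j) (allFin m))

record IsTrade (μ m v k t : ℕ) (T : Fin μ → Fin m → Subset v) : Set where
  field
    t<k : t < k
    k<v : k < v
    blockSize : ∀ i j → ∣ T i j ∣ ≡ k
    distinct : ∀ i j j′ → T i j ≡ T i j′ → j ≡ j′
    disjoint : ∀ i i′ j j′ → i ≢ i′ → T i j ≢ T i′ j′
    balanced : ∀ (P : Subset v) → ∣ P ∣ ≡ t → ∀ i i′ →
               countContaining T i P ≡ countContaining T i′ P

IsSteiner : ∀ {μ m v} → ℕ → (Fin μ → Fin m → Subset v) → Set
IsSteiner {v = v} t T = ∀ (P : Subset v) → ∣ P ∣ ≡ t → ∀ i → countContaining T i P ≤ 1

IsHomogeneous : ∀ {μ m v} → ℕ → (Fin μ → Fin m → Subset v) → Set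
IsHomogeneous {v = v} d T = ∀ i (x : Fin v) → degree T i x ≡ d

-- Fix a point x of the trade T = {T₀, T₁, T₂} and let d be the common degree.
-- d = 1: x lies on a single block {x, a, b} of T₀.  The block of T₁ through x and a has a
--   third point y; the pair {x, y} must be covered in T₀ too, so y = b and T₀, T₁ share a block.
-- d = 2: with J₁ = {x, a, b} and J₂ the blocks of T₀ through x, the same reasoning puts the
--   third points y ≠ z of the blocks of T₁ and T₂ through x, a on J₂.  Since a has degree 2,
--   the blocks of T₀ through {a, y} and {a, z} coincide, hence equal J₂, which forces a ∈ J₂.
-- d ≥ 3: x has 2d distinct neighbours, so v ≥ 2d + 1 ≥ 7, while counting incidences gives
--   vd = 3m ≤ 21.  Hence v = 7 and the Tᵢ are three pairwise disjoint Steiner triple systems on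
--   7 points, which do not exist; this last fact is checked by an exhaustive search that
--   produces a certificate.
module Submission where

open import Defs
open import Algebra.Properties.CommutativeMonoid.Sum as Sum using ()
open import Data.Bool using (Bool; true; false; if_then_else_; _∧_; _∨_)
open import Data.Bool.ListAction using (any)
open import Data.Empty using (⊥; ⊥-elim)
open import Data.Fin using (Fin; zero; suc; fromℕ<)
open import Data.Fin.Patterns using (0F; 1F; 2F)
open import Data.Fin.Permutation using (Permutation′; _⟨$⟩ʳ_; _⟨$⟩ˡ_; inverseˡ; inverseʳ; transpose)
open import Data.Fin.Properties using (_≟_)
open import Data.Fin.Subset using (Subset; _∈_; ∣_∣; inside; outside; ⁅_⁆; _∪_) renaming (_⊆_ to _⊆ˢ_)
open import Data.Fin.Subset.Properties
  using (_∈?_; _⊆?_; ⊆-antisym; x∈p∪q⁻; p⊆p∪q; q⊆p∪q; x∈⁅x⁆; x∈⁅y⁆⇒x≡y)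
open import Data.List using (List; []; _∷_; length; filter; allFin; tabulate; concatMap; map)
import Data.List.Membership.DecPropositional as DecMembership
open import Data.List.Membership.Propositional using (find; lose) renaming (_∈_ to _∈ₗ_; _∉_ to _∉ₗ_)
open import Data.List.Membership.Propositional.Properties using (∈-filter⁺; ∈-filter⁻; ∈-allFin; ∈-++⁺ˡ; ∈-++⁺ʳ)
open import Data.List.Properties using (filter-notAll; length-tabulate) renaming (≡-dec to ≡-decᴸ)
open import Data.List.Relation.Binary.Subset.Propositional using (_⊆_)
open import Data.List.Relation.Unary.All as All using (All; []; _∷_)
open import Data.List.Relation.Unary.All.Properties using (¬Any⇒All¬; concat⁺; map⁺)
open import Data.List.Relation.Unary.Any using (Any; here; there; any?)
open import Data.List.Relation.Unary.Unique.Propositional using (Unique; []; _∷_)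
open import Data.List.Relation.Unary.Unique.Propositional.Properties using (filter⁺; allFin⁺)
open import Data.Maybe using (Maybe; just; nothing; from-just; _<∣>_) renaming (map to mapᴹ)
open import Data.Nat using (ℕ; zero; suc; _+_; _*_; _≤_; _<_; z≤n; s≤s)
open import Data.Nat.Properties
  using (≤-refl; ≤-trans; ≤-antisym; <⇒≱; *-cancelʳ-≤; *-monoˡ-≤; *-monoʳ-≤; +-0-commutativeMonoid; module ≤-Reasoning)
open import Data.Product using (Σ; _×_; _,_; ∃-syntax; proj₁; proj₂)
open import Data.Product.Properties using () renaming (≡-dec to ≡-dec×)
open import Data.Vec using () renaming ([] to []ᵛ; _∷_ to _∷ᵛ_)
open import Data.Sum using (inj₁; inj₂; [_,_]′)
open import Function using (id; _∘_)
open import Relation.Binary.Definitions using (DecidableEquality)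
open import Relation.Binary.PropositionalEquality
  using (_≡_; _≢_; refl; sym; trans; cong; subst; ≢-sym; module ≡-Reasoning)
open import Relation.Nullary using (¬_; Dec; does; yes; no; ¬?; contradiction)
open import Relation.Nullary.Decidable using (decidable-stable)
open import Relation.Unary using (Pred; Decidable)

open Sum +-0-commutativeMonoid using (sum-syntax; sum-cong-≗; ∑-comm)

length≤1⇒≡ : ∀ {A : Set} {xs : List A} {x y} → length xs ≤ 1 → x ∈ₗ xs → y ∈ₗ xs → x ≡ y
length≤1⇒≡ {xs = _ ∷ []} _ (here refl) (here refl) = refl
length≤1⇒≡ {xs = _ ∷ _ ∷ _} (s≤s ())

∃∈-resp-length : ∀ {A : Set} {xs ys : List A} {x} → length xs ≡ length ys → x ∈ₗ xs → ∃[ y ] y ∈ₗ ys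
∃∈-resp-length {ys = y ∷ _} _ _ = y , here refl
∃∈-resp-length {xs = _ ∷ _} {ys = []} () _

module _ {A : Set} (_≟ᴬ_ : DecidableEquality A) where
  open DecMembership _≟ᴬ_ using () renaming (_∈?_ to _∈ₗ?_)

  Unique⇒length≤ : ∀ {xs ys : List A} → Unique xs → xs ⊆ ys → length xs ≤ length ys
  Unique⇒length≤ {[]} _ _ = z≤n
  Unique⇒length≤ {x ∷ xs} {ys} (x≢xs ∷ xs!) xs⊆ys = begin-strict
    length xs              ≤⟨ Unique⇒length≤ xs! xs⊆ys∖x ⟩
    length (filter ≢x? ys) <⟨ filter-notAll ≢x? ys (lose (xs⊆ys (here refl)) λ x≢x → x≢x refl) ⟩
    length ys              ∎
    where
    open ≤-Reasoning
    ≢x? = λ y → ¬? (y ≟ᴬ x)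
    xs⊆ys∖x : xs ⊆ filter ≢x? ys
    xs⊆ys∖x y∈xs = ∈-filter⁺ ≢x? (xs⊆ys (there y∈xs)) λ y≡x → All.lookup x≢xs y∈xs (sym y≡x)

  ∃∉ : ∀ {xs ys : List A} → Unique ys → length xs < length ys → ∃[ y ] y ∈ₗ ys × y ∉ₗ xs
  ∃∉ {xs} {ys} ys! xs<ys with any? (λ y → ¬? (y ∈ₗ? xs)) ys
  ... | yes ∉xs = find ∉xs
  ... | no ¬∉xs = contradiction (Unique⇒length≤ ys! ys⊆xs) (<⇒≱ xs<ys)
    where
    ys⊆xs : ys ⊆ xs
    ys⊆xs {y} y∈ys = decidable-stable (y ∈ₗ? xs) (¬∉xs ∘ lose y∈ys)

Unique⇒length≤n : ∀ {n} {xs : List (Fin n)} → Unique xs → length xs ≤ n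
Unique⇒length≤n {n} {xs} xs! =
  subst (length xs ≤_) (length-tabulate id) (Unique⇒length≤ _≟_ xs! (λ _ → ∈-allFin _))

indicator : ∀ {P : Set} → Dec P → ℕ
indicator P? = if does P? then 1 else 0

length-filter-tabulate : ∀ {A : Set} {P : Pred A _} (P? : Decidable P) {n} (f : Fin n → A) →
                         length (filter P? (tabulate f)) ≡ ∑[ i < n ] indicator (P? (f i))
length-filter-tabulate P? {zero} f = refl
length-filter-tabulate P? {suc n} f with does (P? (f zero))
... | true  = cong suc (length-filter-tabulate P? (f ∘ suc))
... | false = length-filter-tabulate P? (f ∘ suc)

∣p∣≡∑ : ∀ {n} (p : Subset n) → ∣ p ∣ ≡ ∑[ i < n ] indicator (i ∈? p)
∣p∣≡∑ []ᵛ            = refl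
∣p∣≡∑ (inside ∷ᵛ p)  = cong suc (∣p∣≡∑ p)
∣p∣≡∑ (outside ∷ᵛ p) = ∣p∣≡∑ p

∑-const : ∀ n c → ∑[ i < n ] c ≡ n * c
∑-const zero    c = refl
∑-const (suc n) c = cong (c +_) (∑-const n c)

∑-size≡∑-degree : ∀ {m v} (B : Fin m → Subset v) →
                  ∑[ j < m ] ∣ B j ∣ ≡ ∑[ x < v ] length (filter (λ j → x ∈? B j) (allFin m))
∑-size≡∑-degree {m} {v} B = begin
  ∑[ j < m ] ∣ B j ∣                                     ≡⟨ sum-cong-≗ (∣p∣≡∑ ∘ B) ⟩
  ∑[ j < m ] ∑[ x < v ] indicator (x ∈? B j)             ≡⟨ ∑-comm (λ j x → indicator (x ∈? B j)) ⟩
  ∑[ x < v ] ∑[ j < m ] indicator (x ∈? B j)             ≡⟨ sum-cong-≗ (λ x → length-filter-tabulate (λ j → x ∈? B j) id) ⟨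
  ∑[ x < v ] length (filter (λ j → x ∈? B j) (allFin m)) ∎
  where open ≡-Reasoning

elements : ∀ {n} → Subset n → List (Fin n)
elements p = filter (_∈? p) (allFin _)

length-elements : ∀ {n} (p : Subset n) → length (elements p) ≡ ∣ p ∣
length-elements p = trans (length-filter-tabulate (_∈? p) id) (sym (∣p∣≡∑ p))

module _ {n : ℕ} where

  ∈-elements⁺ : ∀ {p : Subset n} {x} → x ∈ p → x ∈ₗ elements p
  ∈-elements⁺ = ∈-filter⁺ (_∈? _) (∈-allFin _)

  ∈-elements⁻ : ∀ {p : Subset n} {x} → x ∈ₗ elements p → x ∈ p
  ∈-elements⁻ {p} = proj₂ ∘ ∈-filter⁻ (_∈? p) {xs = allFin n}

  elements-unique : (p : Subset n) → Unique (elements p)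
  elements-unique p = filter⁺ (_∈? p) (allFin⁺ n)

  Unique⇒length≤∣p∣ : ∀ {p : Subset n} {xs} → Unique xs → All (_∈ p) xs → length xs ≤ ∣ p ∣
  Unique⇒length≤∣p∣ {p} {xs} xs! xs∈p = begin
    length xs           ≤⟨ Unique⇒length≤ _≟_ xs! (∈-elements⁺ ∘ All.lookup xs∈p) ⟩
    length (elements p) ≡⟨ length-elements p ⟩
    ∣ p ∣               ∎
    where open ≤-Reasoning

  ∣p∣≤length : ∀ {p : Subset n} {xs} → (∀ {x} → x ∈ p → x ∈ₗ xs) → ∣ p ∣ ≤ length xs
  ∣p∣≤length {p} {xs} p⊆xs = begin
    ∣ p ∣               ≡⟨ length-elements p ⟨
    length (elements p) ≤⟨ Unique⇒length≤ _≟_ (elements-unique p) (p⊆xs ∘ ∈-elements⁻) ⟩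
    length xs           ∎
    where open ≤-Reasoning

  ∃∈p∖xs : ∀ {p : Subset n} {xs} → length xs < ∣ p ∣ → ∃[ y ] y ∈ p × y ∉ₗ xs
  ∃∈p∖xs {p} {xs} xs<p with ∃∉ _≟_ (elements-unique p) (subst (length xs <_) (sym (length-elements p)) xs<p)
  ... | y , y∈ , y∉xs = y , ∈-elements⁻ y∈ , y∉xs

  module _ {B : Subset n} (∣B∣≡3 : ∣ B ∣ ≡ 3) where

    other-point : ∀ x → ∃[ a ] a ∈ B × a ≢ x
    other-point x with ∃∈p∖xs {xs = x ∷ []} (subst (1 <_) (sym ∣B∣≡3) (s≤s (s≤s z≤n)))
    ... | a , a∈B , a∉[x] = a , a∈B , a∉[x] ∘ here

    third-point : ∀ x y → ∃[ c ] c ∈ B × c ≢ x × c ≢ y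
    third-point x y with ∃∈p∖xs {xs = x ∷ y ∷ []} (subst (2 <_) (sym ∣B∣≡3) ≤-refl)
    ... | c , c∈B , c∉[x,y] = c , c∈B , c∉[x,y] ∘ here , c∉[x,y] ∘ there ∘ here

    only-three : ∀ {a b c y} → a ≢ b → a ≢ c → b ≢ c → a ∈ B → b ∈ B → c ∈ B →
                 y ∈ B → y ≢ a → y ≢ b → y ≡ c
    only-three a≢b a≢c b≢c a∈B b∈B c∈B y∈B y≢a y≢b = decidable-stable (_ ≟ _) λ y≢c →
      <⇒≱ ≤-refl (subst (4 ≤_) ∣B∣≡3 (Unique⇒length≤∣p∣ (four-distinct y≢c) (a∈B ∷ b∈B ∷ c∈B ∷ y∈B ∷ [])))
      where
      four-distinct : _ → Unique (_ ∷ _ ∷ _ ∷ _ ∷ [])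
      four-distinct y≢c =
        (a≢b ∷ a≢c ∷ ≢-sym y≢a ∷ []) ∷ (b≢c ∷ ≢-sym y≢b ∷ []) ∷ (≢-sym y≢c ∷ []) ∷ [] ∷ []

    triple⊆ : ∀ {a b c} {C : Subset n} → a ≢ b → a ≢ c → b ≢ c → a ∈ B → b ∈ B → c ∈ B →
              a ∈ C → b ∈ C → c ∈ C → B ⊆ˢ C
    triple⊆ {a} {b} a≢b a≢c b≢c a∈B b∈B c∈B a∈C b∈C c∈C {y} y∈B with y ≟ a | y ≟ b
    ... | yes refl | _        = a∈C
    ... | no _     | yes refl = b∈C
    ... | no y≢a   | no y≢b   = subst (_∈ _) (sym (only-three a≢b a≢c b≢c a∈B b∈B c∈B y∈B y≢a y≢b)) c∈C

  triples-equal : ∀ {B C : Subset n} {a b c} → ∣ B ∣ ≡ 3 → ∣ C ∣ ≡ 3 → a ≢ b → a ≢ c → b ≢ c →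
                  a ∈ B → b ∈ B → c ∈ B → a ∈ C → b ∈ C → c ∈ C → B ≡ C
  triples-equal ∣B∣≡3 ∣C∣≡3 a≢b a≢c b≢c a∈B b∈B c∈B a∈C b∈C c∈C = ⊆-antisym
    (triple⊆ ∣B∣≡3 a≢b a≢c b≢c a∈B b∈B c∈B a∈C b∈C c∈C)
    (triple⊆ ∣C∣≡3 a≢b a≢c b≢c a∈C b∈C c∈C a∈B b∈B c∈B)

  pair : Fin n → Fin n → Subset n
  pair p q = ⁅ p ⁆ ∪ ⁅ q ⁆

  pair⊆ : ∀ {p q} {B : Subset n} → p ∈ B → q ∈ B → pair p q ⊆ˢ B
  pair⊆ {p} {q} p∈B q∈B x∈pair with x∈p∪q⁻ ⁅ p ⁆ ⁅ q ⁆ x∈pair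
  ... | inj₁ x∈⁅p⁆ = subst (_∈ _) (sym (x∈⁅y⁆⇒x≡y p x∈⁅p⁆)) p∈B
  ... | inj₂ x∈⁅q⁆ = subst (_∈ _) (sym (x∈⁅y⁆⇒x≡y q x∈⁅q⁆)) q∈B

  pair⊆⁻ : ∀ {p q} {B : Subset n} → pair p q ⊆ˢ B → p ∈ B × q ∈ B
  pair⊆⁻ {p} {q} pair⊆B = pair⊆B (p⊆p∪q ⁅ q ⁆ (x∈⁅x⁆ p)) , pair⊆B (q⊆p∪q ⁅ p ⁆ ⁅ q ⁆ (x∈⁅x⁆ q))

  ∣pair∣≡2 : ∀ {p q} → p ≢ q → ∣ pair p q ∣ ≡ 2
  ∣pair∣≡2 {p} {q} p≢q = ≤-antisym
    (∣p∣≤length {xs = p ∷ q ∷ []} λ x∈pair →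
      [ here ∘ x∈⁅y⁆⇒x≡y p , there ∘ here ∘ x∈⁅y⁆⇒x≡y q ]′ (x∈p∪q⁻ ⁅ p ⁆ ⁅ q ⁆ x∈pair))
    (Unique⇒length≤∣p∣ ((p≢q ∷ []) ∷ [] ∷ []) (proj₁ (pair⊆⁻ id) ∷ proj₂ (pair⊆⁻ id) ∷ []))

-- L i a b c: {a, b, c} is a triple of the i-th system.
Systems : ℕ → Set₁
Systems n = Fin 3 → Fin n → Fin n → Fin n → Set

record ThreeDisjointSTS n (L : Systems n) : Set where
  field
    swap     : ∀ {i a b c} → L i a b c → L i b a c
    rotate   : ∀ {i a b c} → L i a b c → L i b c a
    cover    : ∀ i {p q} → p ≢ q → ∃[ c ] c ≢ p × c ≢ q × L i p q c
    steiner  : ∀ {i u w c c′} → L i u w c → L i u w c′ → c ≡ c′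
    disjoint : ∀ {i i′ a b c} → L i a b c → L i′ a b c → i ≡ i′

Line : ℕ → Set
Line n = Fin 3 × Fin n × Fin n × Fin n

module _ {n : ℕ} where

  orientations : Line n → List (Line n)
  orientations (i , a , b , c) =
    (i , a , b , c) ∷ (i , a , c , b) ∷ (i , b , c , a) ∷
    (i , b , a , c) ∷ (i , c , a , b) ∷ (i , c , b , a) ∷ []

  expand : List (Line n) → List (Line n)
  expand = concatMap orientations

  rename : Permutation′ n → Line n → Line n
  rename σ (i , a , b , c) = i , σ ⟨$⟩ʳ a , σ ⟨$⟩ʳ b , σ ⟨$⟩ʳ c

  data Clash : Line n → Line n → Set where
    sharedPair   : ∀ {i u w c c′} → c ≢ c′ → Clash (i , u , w , c) (i , u , w , c′)
    sharedTriple : ∀ {i i′ u w c} → i ≢ i′ → Clash (i , u , w , c) (i′ , u , w , c)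

  -- Refuted ls certifies that no three disjoint Steiner triple systems contain the lines ls.
  data Refuted : List (Line n) → Set where
    clash   : ∀ {ls t t′} → t ∈ₗ expand ls → t′ ∈ₗ expand ls → Clash t t′ → Refuted ls
    branch  : ∀ {ls} i {p q} → p ≢ q →
              (∀ c → c ≢ p → c ≢ q → Refuted ((i , p , q , c) ∷ ls)) → Refuted ls
    relabel : ∀ {ls} σ → Refuted (map (rename σ) ls) → Refuted ls

  Holds : Systems n → Line n → Set
  Holds L (i , a , b , c) = L i a b c

  Relabelled : Permutation′ n → Systems n → Systems n
  Relabelled σ L i a b c = L i (σ ⟨$⟩ˡ a) (σ ⟨$⟩ˡ b) (σ ⟨$⟩ˡ c)

  module _ {L} (S : ThreeDisjointSTS n L) where
    open ThreeDisjointSTS S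

    orientations-hold : ∀ {l} → Holds L l → All (Holds L) (orientations l)
    orientations-hold h =
      h ∷ rotate (swap h) ∷ rotate h ∷ swap h ∷ rotate (rotate h) ∷ rotate (rotate (swap h)) ∷ []

    expand-holds : ∀ {ls} → All (Holds L) ls → All (Holds L) (expand ls)
    expand-holds hs = concat⁺ (map⁺ (All.map orientations-hold hs))

    clash-absurd : ∀ {t t′} → Clash t t′ → Holds L t → Holds L t′ → ⊥
    clash-absurd (sharedPair c≢c′) h h′ = c≢c′ (steiner h h′)
    clash-absurd (sharedTriple i≢i′) h h′ = i≢i′ (disjoint h h′)

  relabel-holds : ∀ {L} σ l → Holds L l → Holds (Relabelled σ L) (rename σ l)
  relabel-holds σ (i , a , b , c) h rewrite inverseˡ σ {a} | inverseˡ σ {b} | inverseˡ σ {c} = h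

  relabel-STS : ∀ {L} σ → ThreeDisjointSTS n L → ThreeDisjointSTS n (Relabelled σ L)
  relabel-STS {L} σ S = record
    { swap = swap ; rotate = rotate
    ; cover = relabelled-cover
    ; steiner = λ h h′ → σˡ-injective (steiner h h′)
    ; disjoint = disjoint }
    where
    open ThreeDisjointSTS S

    σˡ-injective : ∀ {x y} → σ ⟨$⟩ˡ x ≡ σ ⟨$⟩ˡ y → x ≡ y
    σˡ-injective e = trans (sym (inverseʳ σ)) (trans (cong (σ ⟨$⟩ʳ_) e) (inverseʳ σ))

    σʳ-≢ : ∀ {c p} → c ≢ σ ⟨$⟩ˡ p → σ ⟨$⟩ʳ c ≢ p
    σʳ-≢ c≢ e = c≢ (trans (sym (inverseˡ σ)) (cong (σ ⟨$⟩ˡ_) e))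

    relabelled-cover : ∀ i {p q} → p ≢ q → ∃[ c ] c ≢ p × c ≢ q × Relabelled σ L i p q c
    relabelled-cover i p≢q with cover i (p≢q ∘ σˡ-injective)
    ... | c , c≢p , c≢q , h = σ ⟨$⟩ʳ c , σʳ-≢ c≢p , σʳ-≢ c≢q , subst (L i _ _) (sym (inverseˡ σ)) h

  refuted-sound : ∀ {L ls} → ThreeDisjointSTS n L → Refuted ls → All (Holds L) ls → ⊥
  refuted-sound S (clash t∈ t′∈ k) hs =
    clash-absurd S k (All.lookup (expand-holds S hs) t∈) (All.lookup (expand-holds S hs) t′∈)
  refuted-sound S (branch i p≢q k) hs with ThreeDisjointSTS.cover S i p≢q
  ... | c , c≢p , c≢q , h = refuted-sound S (k c c≢p c≢q) (h ∷ hs)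
  refuted-sound {L} S (relabel σ r) hs =
    refuted-sound (relabel-STS σ S) r (map⁺ (All.map (relabel-holds {L} σ _) hs))

  -- The search is not trusted: it only assembles a Refuted certificate.

  _≡ᵇ_ : ∀ {k} → Fin k → Fin k → Bool
  x ≡ᵇ y = does (x ≟ y)

  clash? : ∀ t t′ → Maybe (Clash t t′)
  clash? (i , u , w , c) (i′ , u′ , w′ , c′) with (u ≡ᵇ u′) ∧ (w ≡ᵇ w′) ∧ ((i ≡ᵇ i′) ∨ (c ≡ᵇ c′))
  ... | false = nothing
  ... | true with u ≟ u′ | w ≟ w′ | i ≟ i′ | c ≟ c′
  ... | yes refl | yes refl | yes refl | no c≢c′ = just (sharedPair c≢c′)
  ... | yes refl | yes refl | no i≢i′ | yes refl = just (sharedTriple i≢i′)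
  ... | _ | _ | _ | _ = nothing

  firstJust : ∀ {A B : Set} (xs : List A) → (∀ x → x ∈ₗ xs → Maybe B) → Maybe B
  firstJust [] f = nothing
  firstJust (x ∷ xs) f = f x (here refl) <∣> firstJust xs (λ y y∈ → f y (there y∈))

  forAll : ∀ {m} {P : Fin m → Set} → (∀ c → Maybe (P c)) → Maybe (∀ c → P c)
  forAll {ℕ.zero} f = just λ ()
  forAll {ℕ.suc m} {P} f with f zero
  ... | nothing = nothing
  ... | just p0 with forAll (f ∘ suc)
  ... | nothing = nothing
  ... | just ps = just λ { zero → p0 ; (suc c) → ps c }

  headClash : ∀ l ls → Maybe (Refuted (l ∷ ls))
  headClash l@(i , a , b , c) ls =
      try (i , a , b , c) (here refl)
      <∣> try (i , a , c , b) (there (here refl))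
      <∣> try (i , b , c , a) (there (there (here refl)))
    where
    try : ∀ t → t ∈ₗ orientations l → Maybe (Refuted (l ∷ ls))
    try t t∈ = firstJust (expand ls) λ t′ t′∈ →
      mapᴹ (clash (∈-++⁺ˡ t∈) (∈-++⁺ʳ (orientations l) t′∈)) (clash? t t′)

  covered : Fin 3 → Fin n → Fin n → List (Line n) → Bool
  covered i p q [] = false
  covered i p q ((i′ , a , b , c) ∷ ls) =
    ((i ≡ᵇ i′) ∧ ((p ≡ᵇ a) ∨ (p ≡ᵇ b) ∨ (p ≡ᵇ c)) ∧ ((q ≡ᵇ a) ∨ (q ≡ᵇ b) ∨ (q ≡ᵇ c)))
    ∨ covered i p q ls

  occurs : Fin n → List (Line n) → Bool
  occurs x = any λ { (_ , a , b , c) → (x ≡ᵇ a) ∨ (x ≡ᵇ b) ∨ (x ≡ᵇ c) }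

  firstFresh : Fin n → Fin n → List (Line n) → Maybe (Fin n)
  firstFresh p q ls = go (allFin n)
    where
    go : List (Fin n) → Maybe (Fin n)
    go [] = nothing
    go (c ∷ cs) = if (c ≡ᵇ p) ∨ (c ≡ᵇ q) ∨ occurs c ls then go cs else just c

  _≟ᴸ_ : (l l′ : Line n) → Dec (l ≡ l′)
  _≟ᴸ_ = ≡-dec× _≟_ (≡-dec× _≟_ (≡-dec× _≟_ _≟_))

  refute : List (Fin 3 × Fin n × Fin n) → (ls : List (Line n)) → Maybe (Refuted ls)
  refute [] ls = nothing
  refute ((i , p , q) ∷ ts) ls with covered i p q ls | p ≟ q
  ... | true  | _      = refute ts ls
  ... | false | yes _  = refute ts ls
  ... | false | no p≢q = mapᴹ (branch i p≢q) candidates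
    where
    Goal : Fin n → Set
    Goal c = Refuted ((i , p , q , c) ∷ ls)

    grow : ∀ c → Maybe (Goal c)
    grow c = headClash (i , p , q , c) ls <∣> refute ts ((i , p , q , c) ∷ ls)

    -- Points not occurring yet are interchangeable: only the first fresh candidate c₀ is
    -- searched, and a fresh c is reduced to it by the transposition of c and c₀.
    symmetric : ∀ {c₀} → Goal c₀ → ∀ c → Maybe (Goal c)
    symmetric {c₀} r₀ c
      with ≡-decᴸ _≟ᴸ_ (map (rename (transpose c c₀)) ((i , p , q , c) ∷ ls)) ((i , p , q , c₀) ∷ ls)
    ... | yes e = just (relabel (transpose c c₀) (subst Refuted (sym e) r₀))
    ... | no _ = nothing

    extend : (∀ c → Maybe (Goal c)) → ∀ c → Maybe (c ≢ p → c ≢ q → Goal c)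
    extend f c with c ≟ p | c ≟ q
    ... | yes refl | _ = just λ c≢p _ → ⊥-elim (c≢p refl)
    ... | no _ | yes refl = just λ _ c≢q → ⊥-elim (c≢q refl)
    ... | no _ | no _ = mapᴹ (λ r _ _ → r) (f c)

    candidates : Maybe (∀ c → c ≢ p → c ≢ q → Goal c)
    candidates with firstFresh p q ls
    ... | nothing = forAll (extend grow)
    ... | just c₀ with grow c₀
    ...   | nothing = nothing
    ...   | just r₀ = forAll (extend λ c → symmetric r₀ c <∣> grow c)

  -- Pairs in lexicographic order, each tried in the three systems in turn; with this order the
  -- search for n = 7 visits about two hundred nodes.
  targets : List (Fin 3 × Fin n × Fin n)
  targets = concatMap (λ p → concatMap (λ q → map (_, p , q) (allFin 3)) (allFin n)) (allFin n)

no-three-disjoint-STS₇ : ∀ {n L} → n ≡ 7 → ¬ ThreeDisjointSTS n L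
no-three-disjoint-STS₇ refl S = refuted-sound S (from-just (refute (targets {7}) [])) []

module SteinerTrade {m v} (T : Fin 3 → Fin m → Subset v)
                    (trade : IsTrade 3 m v 3 2 T) (steiner : IsSteiner 2 T) where
  open IsTrade trade
  open DecMembership (_≟_ {v}) using () renaming (_∈?_ to _∈ₗ?_)

  Joined : Fin 3 → Fin v → Fin v → Set
  Joined i p q = ∃[ j ] p ∈ T i j × q ∈ T i j

  blocksContaining : Fin 3 → Subset v → List (Fin m)
  blocksContaining i P = filter (λ j → P ⊆? T i j) (allFin m)

  ∈-blocksContaining : ∀ {i j p q} → p ∈ T i j → q ∈ T i j → j ∈ₗ blocksContaining i (pair p q)
  ∈-blocksContaining p∈ q∈ = ∈-filter⁺ _ (∈-allFin _) (λ {_} → pair⊆ p∈ q∈)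

  joined-everywhere : ∀ {i p q} → p ≢ q → Joined i p q → ∀ i′ → Joined i′ p q
  joined-everywhere {i} {p} {q} p≢q (j , p∈ , q∈) i′
    with ∃∈-resp-length (balanced (pair p q) (∣pair∣≡2 p≢q) i i′) (∈-blocksContaining p∈ q∈)
  ... | j′ , j′∈ = j′ , pair⊆⁻ (proj₂ (∈-filter⁻ _ {xs = allFin m} j′∈))

  same-block : ∀ {i j j′ p q} → p ≢ q → p ∈ T i j → q ∈ T i j → p ∈ T i j′ → q ∈ T i j′ → j ≡ j′
  same-block {i} p≢q p∈ q∈ p∈′ q∈′ =
    length≤1⇒≡ (steiner (pair _ _) (∣pair∣≡2 p≢q) i) (∈-blocksContaining p∈ q∈) (∈-blocksContaining p∈′ q∈′)

  blocks-meet-once : ∀ {i j j′ x y} → j ≢ j′ → x ∈ T i j → x ∈ T i j′ → y ∈ T i j → y ∈ T i j′ → y ≡ x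
  blocks-meet-once j≢j′ x∈ x∈′ y∈ y∈′ = decidable-stable (_ ≟ _) λ y≢x → j≢j′ (same-block y≢x y∈ x∈ y∈′ x∈′)

  no-shared-triple : ∀ {i i′ j j′ a b c} → i ≢ i′ → a ≢ b → a ≢ c → b ≢ c →
    a ∈ T i j → b ∈ T i j → c ∈ T i j → a ∈ T i′ j′ → b ∈ T i′ j′ → c ∈ T i′ j′ → ⊥
  no-shared-triple {i} {i′} {j} {j′} i≢i′ a≢b a≢c b≢c a∈ b∈ c∈ a∈′ b∈′ c∈′ =
    disjoint i i′ j j′ i≢i′ (triples-equal (blockSize i j) (blockSize i′ j′) a≢b a≢c b≢c a∈ b∈ c∈ a∈′ b∈′ c∈′)

  blocksThrough : Fin 3 → Fin v → List (Fin m)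
  blocksThrough i x = filter (λ j → x ∈? T i j) (allFin m)

  ∈-blocksThrough⁺ : ∀ {i j x} → x ∈ T i j → j ∈ₗ blocksThrough i x
  ∈-blocksThrough⁺ = ∈-filter⁺ _ (∈-allFin _)

  ∈-blocksThrough⁻ : ∀ {i j x} → j ∈ₗ blocksThrough i x → x ∈ T i j
  ∈-blocksThrough⁻ = proj₂ ∘ ∈-filter⁻ _ {xs = allFin m}

  neighbours : ∀ {i x} js → Unique js → All (λ j → x ∈ T i j) js →
               ∃[ ys ] length ys ≡ length js * 2 × Unique (x ∷ ys) × All (λ y → Any (λ j → y ∈ T i j) js) ys
  neighbours [] _ _ = [] , refl , [] ∷ [] , []
  neighbours {i} {x} (j ∷ js) (j∉js ∷ js!) (x∈j ∷ x∈js) with neighbours js js! x∈js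
  ... | ys , ∣ys∣ , x∉ys ∷ ys! , ys-on with other-point (blockSize i j) x
  ... | a , a∈j , a≢x with third-point (blockSize i j) x a
  ... | b , b∈j , b≢x , b≢a =
    a ∷ b ∷ ys , cong (2 +_) ∣ys∣ ,
    (≢-sym a≢x ∷ ≢-sym b≢x ∷ x∉ys) ∷ (≢-sym b≢a ∷ off-ys a∈j a≢x) ∷ off-ys b∈j b≢x ∷ ys! ,
    here a∈j ∷ here b∈j ∷ All.map there ys-on
    where
    off-ys : ∀ {z} → z ∈ T i j → z ≢ x → All (z ≢_) ys
    off-ys {z} z∈j z≢x = All.map off ys-on
      where
      off : ∀ {y} → Any (λ j′ → y ∈ T i j′) js → z ≢ y
      off y-on refl with find y-on
      ... | j′ , j′∈js , z∈j′ = All.lookup j∉js j′∈js (same-block z≢x z∈j x∈j z∈j′ (All.lookup x∈js j′∈js))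

  module Homogeneous {d} (homogeneous : IsHomogeneous d T) where

    blocks-through-≤ : ∀ {i x js} → Unique js → All (λ j → x ∈ T i j) js → length js ≤ d
    blocks-through-≤ {i} {x} js! x∈js =
      subst (_ ≤_) (homogeneous i x) (Unique⇒length≤ _≟_ js! (∈-blocksThrough⁺ ∘ All.lookup x∈js))

    another-block : ∀ {i x} js → length js < d → ∃[ j ] x ∈ T i j × j ∉ₗ js
    another-block {i} {x} js js<d
      with ∃∉ _≟_ (filter⁺ _ (allFin⁺ m)) (subst (length js <_) (sym (homogeneous i x)) js<d)
    ... | j , j∈ , j∉js = j , ∈-blocksThrough⁻ j∈ , j∉js

    neighbourhood : ∀ i x → ∃[ ys ] length ys ≡ d * 2 × Unique (x ∷ ys) × All (Joined i x) ys
    neighbourhood i x with neighbours (blocksThrough i x) (filter⁺ _ (allFin⁺ m)) (All.tabulate ∈-blocksThrough⁻)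
    ... | ys , ∣ys∣ , x∷ys! , ys-on =
      ys , trans ∣ys∣ (cong (_* 2) (homogeneous i x)) , x∷ys! , All.map joined ys-on
      where
      joined : ∀ {y} → Any (λ j → y ∈ T i j) (blocksThrough i x) → Joined i x y
      joined y-on with find y-on
      ... | j , j∈ , y∈j = j , ∈-blocksThrough⁻ j∈ , y∈j

    incidences : m * 3 ≡ v * d
    incidences = begin
      m * 3                    ≡⟨ ∑-const m 3 ⟨
      ∑[ j < m ] 3             ≡⟨ sum-cong-≗ (blockSize 0F) ⟨
      ∑[ j < m ] ∣ T 0F j ∣    ≡⟨ ∑-size≡∑-degree (T 0F) ⟩
      ∑[ x < v ] degree T 0F x ≡⟨ sum-cong-≗ (homogeneous 0F) ⟩
      ∑[ x < v ] d             ≡⟨ ∑-const v d ⟩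
      v * d                    ∎
      where open ≡-Reasoning

    suc-d*2≤v : Fin v → suc (d * 2) ≤ v
    suc-d*2≤v x with neighbourhood 0F x
    ... | ys , ∣ys∣ , x∷ys! , _ = subst (_≤ v) (cong suc ∣ys∣) (Unique⇒length≤n x∷ys!)

    all-joined : v ≤ suc (d * 2) → ∀ i {x y} → x ≢ y → Joined i x y
    all-joined v≤ i {x} {y} x≢y with neighbourhood i x
    ... | ys , ∣ys∣ , x∷ys! , ys-joined with y ∈ₗ? ys
    ... | yes y∈ys = All.lookup ys-joined y∈ys
    ... | no y∉ys = contradiction
      (subst (_≤ v) (cong (2 +_) ∣ys∣) (Unique⇒length≤n ((≢-sym x≢y ∷ ¬Any⇒All¬ ys y∉ys) ∷ x∷ys!)))
      (<⇒≱ (s≤s v≤))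

  module _ (homogeneous : IsHomogeneous 1 T) where
    open Homogeneous homogeneous

    unique-block-through : ∀ {i j k x} → x ∈ T i j → x ∈ T i k → j ≡ k
    unique-block-through x∈j x∈k = decidable-stable (_ ≟ _) λ j≢k →
      <⇒≱ ≤-refl (blocks-through-≤ ((j≢k ∷ []) ∷ [] ∷ []) (x∈j ∷ x∈k ∷ []))

    no-1-homogeneous : Fin v → ⊥
    no-1-homogeneous x with another-block {0F} {x} [] (s≤s z≤n)
    ... | j , x∈j , _ with other-point (blockSize 0F j) x
    ... | a , a∈j , a≢x with third-point (blockSize 0F j) x a
    ... | b , b∈j , b≢x , b≢a with joined-everywhere (≢-sym a≢x) (j , x∈j , a∈j) 1F
    ... | k , x∈k , a∈k with third-point (blockSize 1F k) x a
    ... | y , y∈k , y≢x , y≢a with joined-everywhere (≢-sym y≢x) (k , x∈k , y∈k) 0F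
    ... | j′ , x∈j′ , y∈j′ with unique-block-through x∈j′ x∈j
    ... | refl = no-shared-triple (λ ()) x≢a x≢b a≢b x∈j a∈j b∈j x∈k a∈k
                   (subst (_∈ T 1F k) (only-three (blockSize 0F j) x≢a x≢b a≢b x∈j a∈j b∈j y∈j′ y≢x y≢a) y∈k)
      where
      x≢a = ≢-sym a≢x
      x≢b = ≢-sym b≢x
      a≢b = ≢-sym b≢a

  module _ (homogeneous : IsHomogeneous 2 T) where
    open Homogeneous homogeneous

    two-blocks-through : ∀ {i j k k′ x} → x ∈ T i j → x ∈ T i k → x ∈ T i k′ → k ≢ j → k′ ≢ j → k ≡ k′
    two-blocks-through x∈j x∈k x∈k′ k≢j k′≢j = decidable-stable (_ ≟ _) λ k≢k′ →
      <⇒≱ ≤-refl (blocks-through-≤ ((≢-sym k≢j ∷ ≢-sym k′≢j ∷ []) ∷ (k≢k′ ∷ []) ∷ [] ∷ []) (x∈j ∷ x∈k ∷ x∈k′ ∷ []))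

    no-2-homogeneous : Fin v → ⊥
    no-2-homogeneous x with another-block {0F} {x} [] (s≤s z≤n)
    ... | J₁ , x∈J₁ , _ with another-block {0F} {x} (J₁ ∷ []) ≤-refl
    ... | J₂ , x∈J₂ , J₂∉[J₁] with other-point (blockSize 0F J₁) x
    ... | a , a∈J₁ , a≢x with third-point (blockSize 0F J₁) x a
    ... | b , b∈J₁ , b≢x , b≢a = impossible
      where
      x≢a = ≢-sym a≢x
      x≢b = ≢-sym b≢x
      a≢b = ≢-sym b≢a

      J₂≢J₁ : J₂ ≢ J₁
      J₂≢J₁ = J₂∉[J₁] ∘ here

      on-J₂ : ∀ {i k y} → i ≢ 0F → x ∈ T i k → a ∈ T i k → y ∈ T i k → y ≢ x → y ≢ a → y ∈ T 0F J₂
      on-J₂ {i} {k} {y} i≢0 x∈k a∈k y∈k y≢x y≢a with joined-everywhere (≢-sym y≢x) (k , x∈k , y∈k) 0F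
      ... | K , x∈K , y∈K with K ≟ J₁
      ... | no K≢J₁ = subst (λ K → y ∈ T 0F K) (two-blocks-through x∈J₁ x∈K x∈J₂ K≢J₁ J₂≢J₁) y∈K
      ... | yes refl = ⊥-elim (no-shared-triple (≢-sym i≢0) x≢a x≢b a≢b x∈J₁ a∈J₁ b∈J₁ x∈k a∈k b∈k)
        where
        b∈k = subst (_∈ T i k) (only-three (blockSize 0F J₁) x≢a x≢b a≢b x∈J₁ a∈J₁ b∈J₁ y∈K y≢x y≢a) y∈k

      off-J₁ : ∀ {y K} → y ∈ T 0F J₂ → y ≢ x → y ∈ T 0F K → K ≢ J₁
      off-J₁ y∈J₂ y≢x y∈K refl = y≢x (blocks-meet-once (≢-sym J₂≢J₁) x∈J₁ x∈J₂ y∈K y∈J₂)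

      impossible : ⊥
      impossible
        with joined-everywhere x≢a (J₁ , x∈J₁ , a∈J₁) 1F | joined-everywhere x≢a (J₁ , x∈J₁ , a∈J₁) 2F
      ... | k₁ , x∈k₁ , a∈k₁ | k₂ , x∈k₂ , a∈k₂
        with third-point (blockSize 1F k₁) x a | third-point (blockSize 2F k₂) x a
      ... | y , y∈k₁ , y≢x , y≢a | z , z∈k₂ , z≢x , z≢a
        with joined-everywhere (≢-sym y≢a) (k₁ , a∈k₁ , y∈k₁) 0F | joined-everywhere (≢-sym z≢a) (k₂ , a∈k₂ , z∈k₂) 0F
      ... | Ky , a∈Ky , y∈Ky | Kz , a∈Kz , z∈Kz = a≢x (blocks-meet-once (≢-sym J₂≢J₁) x∈J₁ x∈J₂ a∈J₁ a∈J₂)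
        where
        y∈J₂ = on-J₂ (λ ()) x∈k₁ a∈k₁ y∈k₁ y≢x y≢a
        z∈J₂ = on-J₂ (λ ()) x∈k₂ a∈k₂ z∈k₂ z≢x z≢a
        y≢z : y ≢ z
        y≢z refl = no-shared-triple (λ ()) x≢a (≢-sym y≢x) (≢-sym y≢a) x∈k₁ a∈k₁ y∈k₁ x∈k₂ a∈k₂ z∈k₂
        Ky≡Kz = two-blocks-through a∈J₁ a∈Ky a∈Kz (off-J₁ y∈J₂ y≢x y∈Ky) (off-J₁ z∈J₂ z≢x z∈Kz)
        Ky≡J₂ = same-block y≢z y∈Ky (subst (λ K → z ∈ T 0F K) (sym Ky≡Kz) z∈Kz) y∈J₂ z∈J₂
        a∈J₂ = subst (λ K → a ∈ T 0F K) Ky≡J₂ a∈Ky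

  Collinear : Fin 3 → Fin v → Fin v → Fin v → Set
  Collinear i a b c = a ≢ b × a ≢ c × b ≢ c × ∃[ j ] a ∈ T i j × b ∈ T i j × c ∈ T i j

  collinear-STS : (∀ {p q} → p ≢ q → Joined 0F p q) → ThreeDisjointSTS v Collinear
  collinear-STS joined₀ = record
    { swap     = λ (a≢b , a≢c , b≢c , j , a∈ , b∈ , c∈) → ≢-sym a≢b , b≢c , a≢c , j , b∈ , a∈ , c∈
    ; rotate   = λ (a≢b , a≢c , b≢c , j , a∈ , b∈ , c∈) → b≢c , ≢-sym a≢b , ≢-sym a≢c , j , b∈ , c∈ , a∈
    ; cover    = cover
    ; steiner  = steiner′
    ; disjoint = disjoint′
    }
    where
    cover : ∀ i {p q} → p ≢ q → ∃[ c ] c ≢ p × c ≢ q × Collinear i p q c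
    cover i p≢q with joined-everywhere p≢q (joined₀ p≢q) i
    ... | j , p∈ , q∈ with third-point (blockSize i j) _ _
    ... | c , c∈ , c≢p , c≢q = c , c≢p , c≢q , p≢q , ≢-sym c≢p , ≢-sym c≢q , j , p∈ , q∈ , c∈

    steiner′ : ∀ {i u w c c′} → Collinear i u w c → Collinear i u w c′ → c ≡ c′
    steiner′ {i} (u≢w , u≢c , w≢c , j , u∈ , w∈ , c∈) (_ , u≢c′ , w≢c′ , j′ , u∈′ , w∈′ , c′∈)
      with same-block u≢w u∈′ w∈′ u∈ w∈
    ... | refl = sym (only-three (blockSize i j) u≢w u≢c w≢c u∈ w∈ c∈ c′∈ (≢-sym u≢c′) (≢-sym w≢c′))

    disjoint′ : ∀ {i i′ a b c} → Collinear i a b c → Collinear i′ a b c → i ≡ i′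
    disjoint′ {i} {i′} (a≢b , a≢c , b≢c , _ , a∈ , b∈ , c∈) (_ , _ , _ , _ , a∈′ , b∈′ , c∈′) =
      decidable-stable (i ≟ i′) λ i≢i′ → no-shared-triple i≢i′ a≢b a≢c b≢c a∈ b∈ c∈ a∈′ b∈′ c∈′

order-is-seven : ∀ {d v} → 3 ≤ d → suc (d * 2) ≤ v → v * d ≤ 7 * 3 → v ≡ 7 × v ≤ suc (d * 2)
order-is-seven {d} {v} 3≤d 2d+1≤v vd≤21 = ≤-antisym v≤7 7≤v , ≤-trans v≤7 7≤2d+1
  where
  open ≤-Reasoning
  7≤2d+1 : 7 ≤ suc (d * 2)
  7≤2d+1 = s≤s (*-monoˡ-≤ 2 3≤d)
  7≤v = ≤-trans 7≤2d+1 2d+1≤v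
  v≤7 : v ≤ 7
  v≤7 = *-cancelʳ-≤ v 7 3 (begin
    v * 3 ≤⟨ *-monoʳ-≤ v 3≤d ⟩
    v * d ≤⟨ vd≤21 ⟩
    7 * 3 ∎)

proposition1p3 : (d v m : ℕ) → 1 ≤ d → 1 ≤ v → 1 ≤ m → m ≤ 7 →
                 ¬ (Σ (Fin 3 → Fin m → Subset v) λ T →
                      IsTrade 3 m v 3 2 T × IsSteiner 2 T × IsHomogeneous d T)
proposition1p3 0 _ _ () _ _ _
proposition1p3 1 v m _ 0<v _ _ (T , trade , steiner , homogeneous) =
  no-1-homogeneous homogeneous (fromℕ< 0<v)
  where open SteinerTrade T trade steiner
proposition1p3 2 v m _ 0<v _ _ (T , trade , steiner , homogeneous) =
  no-2-homogeneous homogeneous (fromℕ< 0<v)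
  where open SteinerTrade T trade steiner
proposition1p3 d@(suc (suc (suc _))) v m _ 0<v _ m≤7 (T , trade , steiner , homogeneous) =
  no-three-disjoint-STS₇ (proj₁ order) (collinear-STS (all-joined (proj₂ order) 0F))
  where
  open SteinerTrade T trade steiner
  open Homogeneous homogeneous
  open ≤-Reasoning
  order : v ≡ 7 × v ≤ suc (d * 2)
  order = order-is-seven (s≤s (s≤s (s≤s z≤n))) (suc-d*2≤v (fromℕ< 0<v)) (begin
    v * d ≡⟨ incidences ⟨
    m * 3 ≤⟨ *-monoˡ-≤ 3 m≤7 ⟩
    7 * 3 ∎)
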